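{- Let $0<\alpha<1$, let $h$ be a non-zero integer and let $B$ be a non-empty finite set of integers. If $|B \cap (B+h)|> (1-\alpha) |B|$, then $B$ contains an arithmetic progression $\{b, b+h, \dots, b+(r-1)h\}$ of length $r = \lfloor \frac{1}{\alpha} \rfloor +1$ and difference $h$.
   Context: $B+h=\{b+h : b\in B\}$; $|\cdot|$ denotes cardinality.
   Formalization: The parameter α ranges over the rationals strictly between 0 and 1. -}

module Defs where

open import Data.Nat using (ℕ; suc)
open import Data.Integer as ℤ using (ℤ; _+_; _-_; _*_; +_)
import Data.Integer.Properties as ℤP
open import Data.Rational as ℚ using (ℚ; 0ℚ; 1ℚ; 1/_; floor; positive)
open import Data.Rational.Properties using (pos⇒nonZero)
open import Data.List using (List; length; filter)
open import Data.List.Membership.DecPropositional ℤP._≟_ using (_∈_; _∈?_)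

-- A finite set of integers is represented by a duplicate-free list (see Statement).

intersectShiftCard : List ℤ → ℤ → ℕ
intersectShiftCard B h = length (filter (λ b → (b - h) ∈? B) B)

-- r = ⌊ 1/α ⌋ + 1 for α > 0  (⌊1/α⌋ ≥ 0 here, so taking ∣_∣ is harmless)
rOf : (α : ℚ) → 0ℚ ℚ.< α → ℕ
rOf α α>0 = suc ℤ.∣ floor ((1/ α) {{pos⇒nonZero α {{positive α>0}}}}) ∣

APIn : List ℤ → ℤ → ℤ → ℕ → Set
APIn B b h r = (i : ℕ) → i Data.Nat.< r → (b + (+ i) * h) ∈ B

module Submission where

-- Write α = N/D in lowest terms, L = |B|, I = |B ∩ (B+h)| and S = L − I,
-- the number of c ∈ B with c − h ∉ B.  For a difference k, call a ∈ B a
-- j-start if a, a+k, …, a+jk ∈ B.  Passing from j-starts to (j+1)-starts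
-- discards only the a with a + jk ∈ B but a + (j+1)k ∉ B; as a ↦ a + jk is
-- injective, at most |{c ∈ B : c + k ∉ B}| of them.  Telescoping,
-- L ≤ m·|{c ∈ B : c + k ∉ B}| + #(m-starts), so if the first term is < L an
-- m-start exists, i.e. a progression of length m + 1 (module Progressions).
-- We take k = −h, so the bound reads m·S, and m = ⌊D/N⌋ = ⌊1/α⌋; reading
-- the progression backwards gives difference h.  The hypothesis (1−α)L < I
-- clears to D·L < D·I + N·L, which with N·⌊D/N⌋ ≤ D forces ⌊D/N⌋·S < L.

open import Defs
open import Data.Nat as ℕ using (ℕ; zero; suc; z≤n; s≤s; NonZero)
import Data.Nat.Properties as ℕP
open import Data.Nat.DivMod using (m/n*n≤m)
open import Data.Integer as ℤ using (ℤ; +_; +[1+_]; -[1+_]; 0ℤ; 1ℤ; -_; +<+)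
import Data.Integer.Properties as ℤP
open import Data.Integer.Tactic.RingSolver using (solve)
open import Algebra.Properties.AbelianGroup ℤP.+-0-abelianGroup using (∙-cancelʳ)
open import Data.Rational as ℚ using (ℚ; mkℚ; 0ℚ; 1ℚ; _<_; _-_; _*_; _/_; *<*)
open import Data.Rational.Properties using (normalize-coprime; toℚᵘ-homo-*; toℚᵘ-homo-+; toℚᵘ-mono-<)
import Data.Rational.Unnormalised as ℚᵘ
import Data.Rational.Unnormalised.Properties as ℚᵘP
open import Data.Nat.Coprimality as Coprime using (Coprime; 1-coprimeTo)
open import Data.List using (List; []; _∷_; _++_; length; filter; map)
open import Data.List.Properties using (length-++; length-map)
open import Data.List.Membership.Propositional using (_∈_)
open import Data.List.Membership.DecPropositional ℤP._≟_ using (_∈?_)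
open import Data.List.Membership.Propositional.Properties
  using (∈-∃++; ∈-++⁻; ∈-++⁺ˡ; ∈-++⁺ʳ; ∈-map⁻; ∈-filter⁻; ∈-filter⁺)
open import Data.List.Relation.Unary.Any using (here; there)
import Data.List.Relation.Unary.All as All
open import Data.List.Relation.Unary.AllPairs using (_∷_)
open import Data.List.Relation.Unary.Unique.Propositional using (Unique)
import Data.List.Relation.Unary.Unique.Propositional.Properties as Unique
open import Data.Product using (∃; _,_; proj₁; proj₂)
open import Data.Sum using (inj₁; inj₂)
open import Data.Empty using (⊥-elim)
open import Function using (_∘_)
open import Relation.Nullary using (yes; no; ¬?)
open import Relation.Unary using (Decidable)
open import Relation.Binary.PropositionalEquality
  using (_≡_; _≢_; refl; sym; trans; cong; cong₂; subst; subst₂; module ≡-Reasoning)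

unique-⊆⇒length-≤ : ∀ {A : Set} (xs ys : List A) → Unique xs →
                    (∀ {x} → x ∈ xs → x ∈ ys) → length xs ℕ.≤ length ys
unique-⊆⇒length-≤ [] ys _ _ = z≤n
unique-⊆⇒length-≤ (x ∷ xs) ys (x∉xs ∷ uxs) xs⊆ys
  with us , vs , refl ← ∈-∃++ (xs⊆ys (here refl)) = begin
    suc (length xs)            ≤⟨ s≤s (unique-⊆⇒length-≤ xs (us ++ vs) uxs xs⊆us++vs) ⟩
    suc (length (us ++ vs))    ≡⟨ cong suc (length-++ us) ⟩
    suc (length us ℕ.+ length vs) ≡⟨ sym (ℕP.+-suc (length us) (length vs)) ⟩
    length us ℕ.+ length (x ∷ vs) ≡⟨ sym (length-++ us) ⟩
    length (us ++ x ∷ vs)      ∎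
  where
  open ℕP.≤-Reasoning
  -- every y ∈ xs differs from x, so it lies in the rest of ys
  xs⊆us++vs : ∀ {y} → y ∈ xs → y ∈ us ++ vs
  xs⊆us++vs y∈xs with ∈-++⁻ us (xs⊆ys (there y∈xs))
  ... | inj₁ y∈us         = ∈-++⁺ˡ y∈us
  ... | inj₂ (here refl)  = ⊥-elim (All.lookup x∉xs y∈xs refl)
  ... | inj₂ (there y∈vs) = ∈-++⁺ʳ us y∈vs

injection⇒length-≤ : ∀ {A B : Set} (g : A → B) → (∀ {x y} → g x ≡ g y → x ≡ y) →
                     (xs : List A) (ys : List B) → Unique xs →
                     (∀ {x} → x ∈ xs → g x ∈ ys) → length xs ℕ.≤ length ys
injection⇒length-≤ g g-inj xs ys uxs g[xs]⊆ys = begin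
  length xs         ≡⟨ sym (length-map g xs) ⟩
  length (map g xs) ≤⟨ unique-⊆⇒length-≤ (map g xs) ys (Unique.map⁺ g-inj uxs) map⊆ys ⟩
  length ys         ∎
  where
  open ℕP.≤-Reasoning
  map⊆ys : ∀ {y} → y ∈ map g xs → y ∈ ys
  map⊆ys y∈ with x , x∈xs , refl ← ∈-map⁻ g y∈ = g[xs]⊆ys x∈xs

length-filter-split : ∀ {A : Set} {Q : A → Set} (Q? : Decidable Q) (xs : List A) →
                      length xs ≡ length (filter Q? xs) ℕ.+ length (filter (¬? ∘ Q?) xs)
length-filter-split Q? [] = refl
length-filter-split Q? (x ∷ xs) with Q? x
... | yes _ = cong suc (length-filter-split Q? xs)
... | no _  = trans (cong suc (length-filter-split Q? xs)) (sym (ℕP.+-suc _ _))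

module Progressions (B : List ℤ) (k : ℤ) where

  starts : ℕ → List ℤ
  starts zero    = B
  starts (suc j) = filter (λ a → (a ℤ.+ + suc j ℤ.* k) ∈? B) (starts j)

  starts-terms : ∀ j {a} → a ∈ starts j → ∀ i → i ℕ.≤ j → a ℤ.+ + i ℤ.* k ∈ B
  starts-terms zero {a} a∈B zero z≤n = subst (_∈ B) (sym (ℤP.+-identityʳ a)) a∈B
  starts-terms (suc j) a∈ i i≤1+j with a∈starts , last∈B ← ∈-filter⁻ _ {xs = starts j} a∈
    with ℕP.m≤n⇒m<n∨m≡n i≤1+j
  ... | inj₁ i<1+j = starts-terms j a∈starts i (ℕ.s≤s⁻¹ i<1+j)
  ... | inj₂ refl  = last∈B

  starts⇒AP : ∀ j {a} → a ∈ starts j → APIn B a k (suc j)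
  starts⇒AP j a∈ i i<1+j = starts-terms j a∈ i (ℕ.s≤s⁻¹ i<1+j)

  ends : List ℤ
  ends = filter (λ c → ¬? ((c ℤ.+ k) ∈? B)) B

  blocked : ℕ → List ℤ
  blocked j = filter (λ a → ¬? ((a ℤ.+ + suc j ℤ.* k) ∈? B)) (starts j)

  starts-split : ∀ j → length (starts j) ≡ length (starts (suc j)) ℕ.+ length (blocked j)
  starts-split j = length-filter-split (λ a → (a ℤ.+ + suc j ℤ.* k) ∈? B) (starts j)

  starts-unique : Unique B → ∀ j → Unique (starts j)
  starts-unique uB zero    = uB
  starts-unique uB (suc j) = Unique.filter⁺ _ (starts-unique uB j)

  last-step : ∀ j a → (a ℤ.+ + j ℤ.* k) ℤ.+ k ≡ a ℤ.+ + suc j ℤ.* k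
  last-step j a = begin
    (a ℤ.+ + j ℤ.* k) ℤ.+ k  ≡⟨ ℤP.+-assoc a _ k ⟩
    a ℤ.+ (+ j ℤ.* k ℤ.+ k)  ≡⟨ cong (ℤ._+_ a) (ℤP.+-comm (+ j ℤ.* k) k) ⟩
    a ℤ.+ (k ℤ.+ + j ℤ.* k)  ≡⟨ cong (ℤ._+_ a) (sym (ℤP.suc-* (+ j) k)) ⟩
    a ℤ.+ + suc j ℤ.* k      ∎
    where open ≡-Reasoning

  -- A blocked progression is determined by its last term, which is an end.
  blocked≤ends : Unique B → ∀ j → length (blocked j) ℕ.≤ length ends
  blocked≤ends uB j =
    injection⇒length-≤ shift (λ {x} {y} → ∙-cancelʳ (+ j ℤ.* k) x y)
      (blocked j) ends (Unique.filter⁺ _ (starts-unique uB j)) last∈ends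
    where
    shift : ℤ → ℤ
    shift a = a ℤ.+ + j ℤ.* k
    last∈ends : ∀ {a} → a ∈ blocked j → shift a ∈ ends
    last∈ends {a} a∈ with a∈starts , stuck ← ∈-filter⁻ _ {xs = starts j} a∈ =
      ∈-filter⁺ _ (starts-terms j a∈starts j ℕP.≤-refl)
                  (stuck ∘ subst (_∈ B) (last-step j a))

  -- Telescoping: each step loses at most |ends| starts.
  starts-telescope : Unique B → ∀ j → length B ℕ.≤ j ℕ.* length ends ℕ.+ length (starts j)
  starts-telescope uB zero    = ℕP.≤-refl
  starts-telescope uB (suc j) = begin
    length B                                            ≤⟨ starts-telescope uB j ⟩
    j ℕ.* E ℕ.+ length (starts j)                       ≡⟨ cong (j ℕ.* E ℕ.+_) (starts-split j) ⟩
    j ℕ.* E ℕ.+ (length (starts (suc j)) ℕ.+ length (blocked j))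
                    ≤⟨ ℕP.+-monoʳ-≤ (j ℕ.* E) (ℕP.+-monoʳ-≤ _ (blocked≤ends uB j)) ⟩
    j ℕ.* E ℕ.+ (length (starts (suc j)) ℕ.+ E)         ≡⟨ regroup (j ℕ.* E) _ E ⟩
    E ℕ.+ j ℕ.* E ℕ.+ length (starts (suc j))           ∎
    where
    open ℕP.≤-Reasoning
    E : ℕ
    E = length ends
    regroup : ∀ x y z → x ℕ.+ (y ℕ.+ z) ≡ z ℕ.+ x ℕ.+ y
    regroup x y z = trans (cong (x ℕ.+_) (ℕP.+-comm y z))
                          (trans (sym (ℕP.+-assoc x z y)) (cong (ℕ._+ y) (ℕP.+-comm x z)))

  long-progression : Unique B → ∀ m → m ℕ.* length ends ℕ.< length B → ∃ λ a → APIn B a k (suc m)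
  long-progression uB m few-ends with starts m in eq
  ... | a ∷ _ = a , starts⇒AP m (subst (a ∈_) (sym eq) (here refl))
  ... | []    = ⊥-elim (ℕP.<⇒≱ few-ends (subst (length B ℕ.≤_) no-starts (starts-telescope uB m)))
    where
    no-starts : m ℕ.* length ends ℕ.+ length (starts m) ≡ m ℕ.* length ends
    no-starts = trans (cong (λ xs → m ℕ.* length ends ℕ.+ length xs) eq) (ℕP.+-identityʳ _)

reverse-AP : ∀ B a h m → APIn B a (- h) (suc m) → APIn B (a ℤ.+ + m ℤ.* (- h)) h (suc m)
reverse-AP B a h m backwards i i<1+m
  with l , refl ← ℕP.m≤n⇒∃[o]m+o≡n (ℕ.s≤s⁻¹ i<1+m) =
    subst (_∈ B) (sym mirror) (backwards l (s≤s (ℕP.m≤n+m l i)))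
  where
  cancel-steps : ∀ x y → (a ℤ.+ (x ℤ.+ y) ℤ.* (- h)) ℤ.+ x ℤ.* h ≡ a ℤ.+ y ℤ.* (- h)
  cancel-steps x y = solve (a ∷ h ∷ x ∷ y ∷ [])
  mirror : (a ℤ.+ + (i ℕ.+ l) ℤ.* (- h)) ℤ.+ + i ℤ.* h ≡ a ℤ.+ + l ℤ.* (- h)
  mirror = trans (cong (λ x → (a ℤ.+ x ℤ.* (- h)) ℤ.+ + i ℤ.* h) (ℤP.pos-+ i l))
                 (cancel-steps (+ i) (+ l))

quotient-bound : ∀ N D L I S .{{_ : NonZero N}} → L ≡ I ℕ.+ S →
                 D ℕ.* L ℕ.< D ℕ.* I ℕ.+ N ℕ.* L → (D ℕ./ N) ℕ.* S ℕ.< L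
quotient-bound N D L I S refl dense = ℕP.≰⇒> λ L≤qS → ℕP.<⇒≱ dense (begin
  D ℕ.* I ℕ.+ N ℕ.* L         ≤⟨ ℕP.+-monoʳ-≤ (D ℕ.* I) (ℕP.*-monoʳ-≤ N L≤qS) ⟩
  D ℕ.* I ℕ.+ N ℕ.* (q ℕ.* S) ≡⟨ cong (D ℕ.* I ℕ.+_) (sym (ℕP.*-assoc N q S)) ⟩
  D ℕ.* I ℕ.+ N ℕ.* q ℕ.* S   ≤⟨ ℕP.+-monoʳ-≤ (D ℕ.* I) (ℕP.*-monoˡ-≤ S Nq≤D) ⟩
  D ℕ.* I ℕ.+ D ℕ.* S         ≡⟨ sym (ℕP.*-distribˡ-+ D I S) ⟩
  D ℕ.* L                     ∎)
  where
  open ℕP.≤-Reasoning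
  q : ℕ
  q = D ℕ./ N
  Nq≤D : N ℕ.* q ℕ.≤ D
  Nq≤D = subst (ℕ._≤ D) (ℕP.*-comm q N) (m/n*n≤m D N)

n/1≡mkℚ : ∀ n → (+ n) / 1 ≡ mkℚ (+ n) 0 (Coprime.sym (1-coprimeTo n))
n/1≡mkℚ n = normalize-coprime (Coprime.sym (1-coprimeTo n))

density-ℚᵘ : ∀ n d .(c : Coprime (suc n) (suc d)) L I →
             (1ℚ - mkℚ +[1+ n ] d c) * ((+ L) / 1) < (+ I) / 1 →
             (ℚᵘ.1ℚᵘ ℚᵘ.+ ℚᵘ.mkℚᵘ -[1+ n ] d) ℚᵘ.* ℚᵘ.mkℚᵘ (+ L) 0 ℚᵘ.< ℚᵘ.mkℚᵘ (+ I) 0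
density-ℚᵘ n d c L I hyp rewrite n/1≡mkℚ L | n/1≡mkℚ I =
  ℚᵘP.<-respˡ-≃ (ℚᵘP.≃-trans (toℚᵘ-homo-* (1ℚ - α) _) (ℚᵘP.*-congʳ (toℚᵘ-homo-+ 1ℚ (ℚ.- α))))
                (toℚᵘ-mono-< hyp)
  where
  α : ℚ
  α = mkℚ +[1+ n ] d c

clear-denominator : ∀ D N L → ((1ℤ ℤ.* D ℤ.+ (- N) ℤ.* 1ℤ) ℤ.* L) ℤ.* 1ℤ ℤ.+ N ℤ.* L ≡ D ℤ.* L
clear-denominator D N L = solve (D ∷ N ∷ L ∷ [])

density-in-ℕ : ∀ n d .(c : Coprime (suc n) (suc d)) L I →
               (1ℚ - mkℚ +[1+ n ] d c) * ((+ L) / 1) < (+ I) / 1 →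
               suc d ℕ.* L ℕ.< suc d ℕ.* I ℕ.+ suc n ℕ.* L
density-in-ℕ n d c L I hyp with density-ℚᵘ n d c L I hyp
... | ℚᵘ.*<* cross = ℤP.drop‿+<+ (subst₂ ℤ._<_ lhs rhs (ℤP.+-monoˡ-< (N ℤ.* + L) cross))
  where
  N D : ℤ
  N = + suc n
  D = + suc d
  lhs : ((1ℤ ℤ.* D ℤ.+ (- N) ℤ.* 1ℤ) ℤ.* + L) ℤ.* 1ℤ ℤ.+ N ℤ.* + L ≡ + (suc d ℕ.* L)
  lhs = trans (clear-denominator D N (+ L)) (sym (ℤP.pos-* (suc d) L))
  rhs : + I ℤ.* + ((1 ℕ.* suc d) ℕ.* 1) ℤ.+ N ℤ.* + L ≡ + (suc d ℕ.* I ℕ.+ suc n ℕ.* L)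
  rhs = begin
    + I ℤ.* + ((1 ℕ.* suc d) ℕ.* 1) ℤ.+ N ℤ.* + L
      ≡⟨ cong (λ x → + I ℤ.* + x ℤ.+ N ℤ.* + L) (trans (ℕP.*-identityʳ _) (ℕP.*-identityˡ _)) ⟩
    + I ℤ.* D ℤ.+ N ℤ.* + L      ≡⟨ cong (ℤ._+ N ℤ.* + L) (ℤP.*-comm (+ I) D) ⟩
    D ℤ.* + I ℤ.+ N ℤ.* + L      ≡⟨ sym (cong₂ ℤ._+_ (ℤP.pos-* (suc d) I) (ℤP.pos-* (suc n) L)) ⟩
    + (suc d ℕ.* I) ℤ.+ + (suc n ℕ.* L) ≡⟨ sym (ℤP.pos-+ (suc d ℕ.* I) (suc n ℕ.* L)) ⟩
    + (suc d ℕ.* I ℕ.+ suc n ℕ.* L) ∎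
    where open ≡-Reasoning

rOf-value : ∀ n d .(c : Coprime (suc n) (suc d)) (α>0 : 0ℚ < mkℚ +[1+ n ] d c) →
            rOf (mkℚ +[1+ n ] d c) α>0 ≡ suc (suc d ℕ./ suc n)
rOf-value n d c α>0 = cong suc (trans (ℤP.abs-◃ _ _) (ℕP.+-identityʳ _))

lemma2 : (α : ℚ) → (α>0 : 0ℚ < α) → α < 1ℚ
       → (h : ℤ) → h ≢ 0ℤ
       → (B : List ℤ) → Unique B → B ≢ []
       → (1ℚ - α) * ((+ length B) / 1) < (+ intersectShiftCard B h) / 1
       → ∃ λ b → APIn B b h (rOf α α>0)
lemma2 (mkℚ +[1+ n ] d c) α>0 _ h _ B uB _ hyp =
  subst (λ r → ∃ λ b → APIn B b h r) (sym (rOf-value n d c α>0))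
        (a ℤ.+ + m ℤ.* (- h) , reverse-AP B a h m backwards)
  where
  open Progressions B (- h)
  m I : ℕ
  m = suc d ℕ./ suc n
  I = intersectShiftCard B h
  -- |B| = |B ∩ (B+h)| + |ends|, since c + (−h) ∉ B says c ∉ B + h
  |B|≡I+|ends| : length B ≡ I ℕ.+ length ends
  |B|≡I+|ends| = length-filter-split (λ b → (b ℤ.- h) ∈? B) B
  few-ends : m ℕ.* length ends ℕ.< length B
  few-ends = quotient-bound (suc n) (suc d) (length B) I (length ends) |B|≡I+|ends|
                            (density-in-ℕ n d c (length B) I hyp)
  a : ℤ
  a = proj₁ (long-progression uB m few-ends)
  backwards : APIn B a (- h) (suc m)
  backwards = proj₂ (long-progression uB m few-ends)
lemma2 (mkℚ (+ 0) d c) (*<* (+<+ ())) _ _ _ _ _ _ _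
lemma2 (mkℚ -[1+ n ] d c) (*<* ()) _ _ _ _ _ _ _
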